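{- For each ordered quasi-normal set automaton there is an ordered normal set automaton recognising the same data language.
   Context: Fix an infinite set $\mathcal{D}$ of data values; data words over $\Sigma$ are finite sequences in $(\Sigma\times\mathcal{D})^*$. For a finite set $Y$, $\mathbbm{2}^Y$ is the set of $\{0,1\}$-vectors indexed by $Y$, $e_y$ the unit vector, $\bar 0$ the zero vector; $\mathbf{R}_Y$ the set of binary relations on $Y$; $\rho[\bar z]$ has $y$-entry $1$ iff some $x$ has $z_x=1$ and $(x,y)\in\rho$. A set automaton $\mathcal{A}=(Q,Y,\Sigma,\Delta,I,F,C)$ has finite states $Q$, finite set names $Y$, transitions $\Delta\subseteq Q\times\Sigma\times\mathbbm{2}^Y\times\mathbf{R}_Y\times\mathbbm{2}^Y\times\mathbbm{2}^Y\times Q$, $I,F\subseteq Q$, $C\subseteq\mathbbm{2}^Y$. Configurations $(q,(X_y)_{y\in Y})$, $X_y\subseteq\mathcal{D}$; initial if $q\in I$ and all $X_y=\emptyset$. On input $(a,d)$, transition $(p,\ell,\bar z,\rho,\bar u,\bar v,p')$ applies iff $p=q$, $\ell=a$, $\bar z$ is the characteristic vector of $d$; result $(p',\bar X'')$ with $X'_y=\bigcup_{(x,y)\in\rho}X_x$, $X''_y=(X'_y\cup U_y)\setminus V_y$, $U_y=\{d\}$ iff $u_y=1$ (else $\emptyset$), $V_y=\{d\}$ iff $v_y=1$ (else $\emptyset$). Accepting configuration: $q\in F$ and every data value present in some $X_y$ has characteristic vector in $C$. $L(\mathcal{A})$: data words with a run from an initial to an accepting configuration. Normal: every transition has $\rho$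 a function $Y\to Y$, $\bar u$ a unit vector, $\bar v=\rho[\bar z]$ if $\bar u\ne\rho[\bar z]$, else $\bar 0$. Stable set $y$: $\rho(y)=\{y\}=\rho^{ -1}(y)$ for every global update $\rho$ used. With $S$ the stable sets, the restriction to $Y'=Y\setminus S$ restricts every vector to $Y'$, each $\rho$ to $\rho\cap(Y'\times Y')$, and $C$ to restrictions of its vectors; quasi-normal means this restriction is normal. For a normal set automaton, with $\rho^+$ the transitive closure of the union of global updates, $y$ is bounded if no $z$ with $(z,z)\in\rho^+$ has $z=y$ or $(z,y)\in\rho^+$. A normal set automaton with bounded sets $Z$ is ordered if some linear order $\le$ on its set names puts $Y\setminus Z$ entirely below $Z$ and, for each global update $\rho$ used, there is a partition $Y\setminus Z=Y_0\uplus Y_1$ with $Y_0$ entirely below $Y_1$, $\rho(Y_0)\subseteq Y_1$ and $\rho$ the identity on $Y_1$. A quasi-normal set automaton is ordered if its restriction to the non-stable sets is ordered. -}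

module Defs where

open import Data.Nat using (ℕ; _<_)
open import Data.Fin using (Fin)
open import Data.Bool using (Bool; true; false)
open import Data.List using (List; [])
open import Data.List.Membership.Propositional using (_∈_)
open import Data.Product using (Σ; ∃; ∃-syntax; _×_; _,_)
open import Data.Sum using (_⊎_)
open import Data.Unit using (⊤)
open import Data.Empty using (⊥)
open import Relation.Nullary using (¬_)
open import Relation.Binary.PropositionalEquality using (_≡_)
open import Relation.Binary.Construct.Closure.Transitive using (TransClosure)
open import Function using (Injective)
open import Function.Bundles using (_⇔_)

Infinite : Set → Set
Infinite D = Σ (ℕ → D) (λ f → Injective _≡_ _≡_ f)

-- Set names Y = Fin nY, states Q = Fin nQ.
-- Vectors in 2^Y are functions Fin nY → Bool, relations in R_Y are
-- Boolean matrices Fin nY → Fin nY → Bool.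

record Transition (nΣ nQ nY : ℕ) : Set where
  field
    src    : Fin nQ
    letter : Fin nΣ
    zvec   : Fin nY → Bool
    rho    : Fin nY → Fin nY → Bool
    uvec   : Fin nY → Bool
    vvec   : Fin nY → Bool
    tgt    : Fin nQ

record SetAutomaton (nΣ : ℕ) : Set where
  field
    nQ    : ℕ
    nY    : ℕ
    Δ     : List (Transition nΣ nQ nY)
    I     : Fin nQ → Bool
    F     : Fin nQ → Bool
    C     : List (Fin nY → Bool)

DataWord : ℕ → Set → Set
DataWord nΣ D = List (Fin nΣ × D)

module Semantics {nΣ : ℕ} (D : Set) (A : SetAutomaton nΣ) where
  open SetAutomaton A
  open Transition

  Config : Set₁
  Config = Fin nQ × (Fin nY → D → Set)

  Initial : Config → Set
  Initial (q , X) = I q ≡ true × (∀ y d → ¬ X y d)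

  CharVec : (Fin nY → D → Set) → D → (Fin nY → Bool) → Set
  CharVec X d z = ∀ y → (z y ≡ true ⇔ X y d)

  Accepting : Config → Set
  Accepting (q , X) =
    F q ≡ true ×
    (∀ d → (∃[ y ] X y d) → ∃[ c ] (c ∈ C × CharVec X d c))

  Step : Config → Fin nΣ × D → Config → Set
  Step (q , X) (a , d) (q' , X'') =
    ∃[ t ] (t ∈ Δ × src t ≡ q × letter t ≡ a × CharVec X d (zvec t)
      × tgt t ≡ q'
      × (∀ y e → X'' y e ⇔
           (((∃[ x ] (rho t x y ≡ true × X x e)) ⊎ (uvec t y ≡ true × e ≡ d))
             × ¬ (vvec t y ≡ true × e ≡ d))))

  data Run : Config → DataWord nΣ D → Config → Set₁ where
    done : ∀ {c} → Run c [] c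
    step : ∀ {c c' c'' ad w} → Step c ad c' → Run c' w c'' →
           Run c (Data.List._∷_ ad w) c''

  Accepts : DataWord nΣ D → Set₁
  Accepts w = ∃[ c ] ∃[ c' ] (Initial c × Run c w c' × Accepting c')

SameLanguage : ∀ {nΣ} (D : Set) → SetAutomaton nΣ → SetAutomaton nΣ → Set₁
SameLanguage D A B =
  ∀ w → Semantics.Accepts D A w ⇔ Semantics.Accepts D B w

-- Restricting A to P (vectors restricted to P, each ρ to ρ ∩ (P × P))
-- and asking the structural property of the restriction is exactly
-- the corresponding notion below with parameter P.  Taking P = all
-- of Y gives the unrestricted notion.

module Structure {nΣ : ℕ} (A : SetAutomaton nΣ) where
  open SetAutomaton A
  open Transition

  Stable : Fin nY → Set
  Stable y = ∀ t → t ∈ Δ → ∀ x →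
    ((rho t y x ≡ true) ⇔ (x ≡ y)) × ((rho t x y ≡ true) ⇔ (x ≡ y))

  NonStable : Fin nY → Set
  NonStable y = ¬ Stable y

  AllNames : Fin nY → Set
  AllNames _ = ⊤

  module On (P : Fin nY → Set) where

    IsFunction : (Fin nY → Fin nY → Bool) → Set
    IsFunction ρ = ∀ x → P x →
      ∃[ y ] (P y × ρ x y ≡ true × (∀ y' → P y' → ρ x y' ≡ true → y' ≡ y))

    IsUnit : (Fin nY → Bool) → Set
    IsUnit u = ∃[ y ] (P y × u y ≡ true × (∀ y' → P y' → u y' ≡ true → y' ≡ y))

    Img : (Fin nY → Fin nY → Bool) → (Fin nY → Bool) → Fin nY → Set
    Img ρ z y = ∃[ x ] (P x × z x ≡ true × ρ x y ≡ true)

    EqImg : (Fin nY → Bool) → (Fin nY → Fin nY → Bool) → (Fin nY → Bool) → Set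
    EqImg u ρ z = ∀ y → P y → (u y ≡ true ⇔ Img ρ z y)

    NormalTransition : Transition nΣ nQ nY → Set
    NormalTransition t =
      IsFunction (rho t) × IsUnit (uvec t) ×
      (¬ EqImg (uvec t) (rho t) (zvec t) →
         ∀ y → P y → (vvec t y ≡ true ⇔ Img (rho t) (zvec t) y)) ×
      (EqImg (uvec t) (rho t) (zvec t) → ∀ y → P y → vvec t y ≡ false)

    Normal : Set
    Normal = ∀ t → t ∈ Δ → NormalTransition t

    Upd : Fin nY → Fin nY → Set
    Upd x y = P x × P y × ∃[ t ] (t ∈ Δ × rho t x y ≡ true)

    Upd⁺ : Fin nY → Fin nY → Set
    Upd⁺ = TransClosure Upd

    Bounded : Fin nY → Set
    Bounded y = ¬ (∃[ z ] (Upd⁺ z z × (z ≡ y ⊎ Upd⁺ z y)))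

    -- a linear order on P is given by a ranking injective on P:
    -- x is below y iff rank x < rank y.
    Ordered : Set
    Ordered =
      Normal ×
      Σ (Fin nY → ℕ) λ rank → (
        (∀ x y → P x → P y → rank x ≡ rank y → x ≡ y) ×
        (∀ x y → P x → P y → ¬ Bounded x → Bounded y → rank x < rank y) ×
        (∀ t → t ∈ Δ →
          -- partition of P \ Z into Y0 (side false) and Y1 (side true)
          Σ (Fin nY → Bool) λ side → (
            (∀ x y → P x → P y → ¬ Bounded x → ¬ Bounded y →
               side x ≡ false → side y ≡ true → rank x < rank y) ×
            (∀ x y → P x → P y → ¬ Bounded x → side x ≡ false →
               rho t x y ≡ true → (¬ Bounded y × side y ≡ true)) ×
            (∀ x → P x → ¬ Bounded x → side x ≡ true →
               rho t x x ≡ true × (∀ y → P y → rho t x y ≡ true → y ≡ x)))))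

  QuasiNormal : Set
  QuasiNormal = On.Normal NonStable

  OrderedQuasiNormal : Set
  OrderedQuasiNormal = On.Ordered NonStable

  IsNormal : Set
  IsNormal = On.Normal AllNames

  OrderedNormal : Set
  OrderedNormal = On.Ordered AllNames

{-# OPTIONS --safe #-}

-- The normal automaton B has one set name for every vector c ∈ 2^Y of A, and a data value lies
-- in set c of B exactly when c is its characteristic vector in A.  By quasi-normality every stored
-- value lies in exactly one non-stable set of A, so only the vectors that are unit on the non-stable
-- names ("proper" names of B) ever hold data.  A global update ρ of A moves the values of vector c
-- to the vector ρ[c], which makes the global update of B a function, and reading d moves d from its
-- old set to the set of its new vector, so B is normal.  Equality on D is not decidable, so the
-- configurations along a run are represented by finite stores of distinct data values with their
-- vectors, on which both automata are simulated step by step.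
-- Update paths of B between proper names project to update paths of A between their non-stable
-- names, and paths of A lift back by replacing the non-stable part of a vector; hence a proper name
-- is bounded in B iff its non-stable name is bounded in A, while no update ever enters an improper
-- name.  Ranking B's names by the rank of their non-stable name (improper names on top) and then by
-- the name itself, with sides inherited from A, makes B ordered.

module Submission where

open import Defs
open import Data.Nat using (ℕ)
open import Data.Product using (∃-syntax; _×_)

open import Data.Nat using (zero; suc; _^_; _<_; _≤_; s≤s)
open import Data.Nat.Properties using (m≤n⇒m≤1+n)
open import Data.Fin using (Fin; zero; suc; toℕ; fromℕ; fromℕ<; funToFin; finToFun; combine)
open import Data.Fin.Properties
  using ( _≟_; any?; all?; 2↔Bool; finToFun-funToFin; funToFin-finToFin
        ; toℕ-injective; toℕ-fromℕ; toℕ-fromℕ<; combine-monoˡ-<; combine-injectiveʳ)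
open import Data.Bool using (Bool; true; false; _∧_; _∨_; not)
open import Data.Bool.Properties using () renaming (_≟_ to _≟ᵇ_)

open import Data.List using (List; []; _∷_; map; allFin)
open import Data.List.Extrema.Nat using (max; xs≤max)
open import Data.List.Relation.Unary.Any as Any using (Any; here; there; _─_)
open import Data.List.Relation.Unary.Any.Properties using (map⁺; map⁻; lookup-result)
open import Data.List.Relation.Unary.All as All using (All; []; _∷_)
open import Data.List.Relation.Unary.All.Properties
  using (─⁺; ¬Any⇒All¬; All¬⇒¬Any) renaming (map⁺ to map⁺ᴬ)
open import Data.List.Relation.Unary.AllPairs using (AllPairs; []; _∷_)
open import Data.List.Relation.Unary.AllPairs.Properties using () renaming (map⁺ to map⁺ᴬᴾ)
open import Data.List.Membership.Propositional using (_∈_)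
open import Data.List.Membership.Propositional.Properties using (∈-map⁺; ∈-map⁻; ∈-allFin)
open import Data.Product using (Σ; _,_; proj₁; proj₂; map₂)
open import Data.Unit using (⊤; tt)
open import Data.Sum using (_⊎_; inj₁; inj₂; [_,_]′)
open import Data.Sum.Function.Propositional using (_⊎-⇔_)
open import Data.Empty using (⊥-elim)
open import Relation.Nullary using (¬_; Dec; yes; no; does)
open import Relation.Nullary.Decidable
  using (_×-dec_; _→-dec_; ¬?; map′; toSum; decidable-stable; dec-false)
open import Relation.Binary.PropositionalEquality
  using (_≡_; _≢_; refl; sym; trans; cong; cong₂; subst; subst₂; _≗_; module ≡-Reasoning)
open import Relation.Binary.Construct.Closure.Transitive using ([_]; _∷_; _∷ʳ_)
open import Function using (_∘_)
open import Function.Bundles using (_⇔_; mk⇔; Equivalence; Inverse)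
import Function.Properties.Equivalence as ⇔

open Equivalence

private
  variable
    m n : ℕ

true≢false : true ≢ false
true≢false ()

_⇔-dec_ : ∀ {P Q : Set} → Dec P → Dec Q → Dec (P ⇔ Q)
p? ⇔-dec q? = map′ (λ (f , g) → mk⇔ f g) (λ e → to e , from e)
                   ((p? →-dec q?) ×-dec (q? →-dec p?))

does⇔ : ∀ {P : Set} (p? : Dec P) → does p? ≡ true ⇔ P
does⇔ (yes p) = mk⇔ (λ _ → p) (λ _ → refl)
does⇔ (no ¬p) = mk⇔ (λ ()) (λ p → ⊥-elim (¬p p))

bool-ext : ∀ {a b : Bool} → (a ≡ true ⇔ b ≡ true) → a ≡ b
bool-ext {false} {false} _ = refl
bool-ext {false} {true}  e = from e refl
bool-ext {true}  {false} e = sym (to e refl)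
bool-ext {true}  {true}  _ = refl

Bits : ℕ → Set
Bits m = Fin m → Bool

≗⇒⇔ : {c c′ : Bits m} → c ≗ c′ → ∀ y → c y ≡ true ⇔ c′ y ≡ true
≗⇒⇔ c≗c′ y = mk⇔ (trans (sym (c≗c′ y))) (trans (c≗c′ y))

BoolRel : ℕ → Set
BoolRel m = Fin m → Fin m → Bool

⁅_⁆ : Fin m → Bits m
⁅ k ⁆ j = does (k ≟ j)

⁅⁆-true : (k j : Fin m) → ⁅ k ⁆ j ≡ true ⇔ k ≡ j
⁅⁆-true k j = does⇔ (k ≟ j)

Nonzero : Bits m → Set
Nonzero c = ∃[ y ] c y ≡ true

nonzero? : (c : Bits m) → Dec (Nonzero c)
nonzero? c = any? (λ y → c y ≟ᵇ true)

image? : (ρ : BoolRel m) (c : Bits m) (y : Fin m) → Dec (∃[ x ] (c x ≡ true × ρ x y ≡ true))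
image? ρ c y = any? λ x → (c x ≟ᵇ true) ×-dec (ρ x y ≟ᵇ true)

image : BoolRel m → Bits m → Bits m
image ρ c y = does (image? ρ c y)

image-true : (ρ : BoolRel m) (c : Bits m) (y : Fin m) →
  image ρ c y ≡ true ⇔ (∃[ x ] (c x ≡ true × ρ x y ≡ true))
image-true ρ c y = does⇔ (image? ρ c y)

image-cong : (ρ : BoolRel m) {c c′ : Bits m} → c ≗ c′ → image ρ c ≗ image ρ c′
image-cong ρ {c} {c′} c≗c′ y = bool-ext (mk⇔
  (λ im → let (x , cx , r) = to (image-true ρ c y) im
          in from (image-true ρ c′ y) (x , to (≗⇒⇔ c≗c′ x) cx , r))
  (λ im → let (x , cx , r) = to (image-true ρ c′ y) im
          in from (image-true ρ c y) (x , from (≗⇒⇔ c≗c′ x) cx , r)))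

image-⁅⁆ : (f : Fin m → Fin m) (k : Fin m) → image (⁅_⁆ ∘ f) ⁅ k ⁆ ≗ ⁅ f k ⁆
image-⁅⁆ f k j = bool-ext (⇔.trans (image-true (⁅_⁆ ∘ f) ⁅ k ⁆ j) (⇔.trans
  (mk⇔ (λ (x , kx , r) → subst (λ w → f w ≡ j) (sym (to (⁅⁆-true k x) kx))
                                 (to (⁅⁆-true (f x) j) r))
       (λ fk≡j → k , from (⁅⁆-true k k) refl , from (⁅⁆-true (f k) j) fk≡j))
  (⇔.sym (⁅⁆-true (f k) j))))

updated : BoolRel m → (z u v : Bits m) → Bits m
updated ρ z u v y = (image ρ z y ∨ u y) ∧ not (v y)

updated-true : (ρ : BoolRel m) (z u v : Bits m) (y : Fin m) →
  updated ρ z u v y ≡ true ⇔ ((image ρ z y ≡ true ⊎ u y ≡ true) × ¬ v y ≡ true)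
updated-true ρ z u v y with image ρ z y | u y | v y
... | true  | _     | false = mk⇔ (λ _ → inj₁ refl , λ ()) (λ _ → refl)
... | false | true  | false = mk⇔ (λ _ → inj₂ refl , λ ()) (λ _ → refl)
... | false | false | false = mk⇔ (λ ()) λ { (inj₁ () , _) ; (inj₂ () , _) }
... | true  | _     | true  = mk⇔ (λ ()) (λ (_ , ¬v) → ⊥-elim (¬v refl))
... | false | true  | true  = mk⇔ (λ ()) (λ (_ , ¬v) → ⊥-elim (¬v refl))
... | false | false | true  = mk⇔ (λ ()) (λ (_ , ¬v) → ⊥-elim (¬v refl))

funToFin-cong : {f g : Fin m → Fin n} → f ≗ g → funToFin f ≡ funToFin g
funToFin-cong {zero}  _   = refl
funToFin-cong {suc m} f≗g = cong₂ combine (f≗g zero) (funToFin-cong (f≗g ∘ suc))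

encode : Bits n → Fin (2 ^ n)
encode c = funToFin (Inverse.from 2↔Bool ∘ c)

decode : Fin (2 ^ n) → Bits n
decode i = Inverse.to 2↔Bool ∘ finToFun i

decode-encode : (c : Bits n) → decode (encode c) ≗ c
decode-encode c y = trans (cong (Inverse.to 2↔Bool) (finToFun-funToFin _ y))
                          (Inverse.strictlyInverseˡ 2↔Bool (c y))

encode-decode : (i : Fin (2 ^ n)) → encode (decode {n} i) ≡ i
encode-decode {n} i = trans (funToFin-cong {m = n} (Inverse.strictlyInverseʳ 2↔Bool ∘ finToFun i))
                            (funToFin-finToFin {n} i)

encode-cong : {c c′ : Bits n} → c ≗ c′ → encode c ≡ encode c′
encode-cong c≗c′ = funToFin-cong (cong (Inverse.from 2↔Bool) ∘ c≗c′)

encode-injective : {c c′ : Bits n} → encode c ≡ encode c′ → c ≗ c′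
encode-injective {c = c} {c′} eq y =
  trans (sym (decode-encode c y)) (trans (cong (λ i → decode i y) eq) (decode-encode c′ y))

encodedChar? : (z : Bits n) (j : Fin (2 ^ n)) → Dec (Nonzero z × encode z ≡ j)
encodedChar? z j = nonzero? z ×-dec (encode z ≟ j)

encodedChar : Bits n → Bits (2 ^ n)
encodedChar z j = does (encodedChar? z j)

encodedChar-true : (z : Bits n) (j : Fin (2 ^ n)) → encodedChar z j ≡ true ⇔ (Nonzero z × encode z ≡ j)
encodedChar-true z j = does⇔ (encodedChar? z j)

Any-─ : ∀ {A : Set} {P G : A → Set} {xs : List A} (a : Any P xs) →
  Any G xs ⇔ (G (Any.lookup a) ⊎ Any G (xs ─ a))
Any-─ {P = P} {G} a = mk⇔ (to′ a) (from′ a)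
  where
  to′ : ∀ {xs} (a : Any P xs) → Any G xs → G (Any.lookup a) ⊎ Any G (xs ─ a)
  to′ (here _)  (here g)  = inj₁ g
  to′ (here _)  (there g) = inj₂ g
  to′ (there _) (here g)  = inj₂ (here g)
  to′ (there a) (there g) = [ inj₁ , inj₂ ∘ there ]′ (to′ a g)
  from′ : ∀ {xs} (a : Any P xs) → G (Any.lookup a) ⊎ Any G (xs ─ a) → Any G xs
  from′ (here _)  (inj₁ g)         = here g
  from′ (here _)  (inj₂ g)         = there g
  from′ (there a) (inj₁ g)         = there (from′ a (inj₁ g))
  from′ (there a) (inj₂ (here g))  = here g
  from′ (there a) (inj₂ (there g)) = there (from′ a (inj₂ g))

AllPairs-─ : ∀ {A : Set} {P : A → Set} {R : A → A → Set} {xs : List A} (a : Any P xs) →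
  AllPairs R xs → AllPairs R (xs ─ a)
AllPairs-─ (here _)  (_ ∷ rs) = rs
AllPairs-─ (there a) (r ∷ rs) = ─⁺ a r ∷ AllPairs-─ a rs

module Stores (D : Set) where

  Entry : ℕ → Set
  Entry m = D × Bits m

  Store : ℕ → Set
  Store m = List (Entry m)

  ⟦_⟧ : Store m → Fin m → D → Set
  ⟦ L ⟧ y e = Any (λ p → e ≡ proj₁ p × proj₂ p y ≡ true) L

  _∈ˢ_ : D → Store m → Set
  d ∈ˢ L = Any (λ p → d ≡ proj₁ p) L

  Distinct : Store m → Set
  Distinct = AllPairs (λ p q → proj₁ p ≢ proj₁ q)

  mapBits : (Bits m → Bits n) → Store m → Store n
  mapBits F = map (map₂ F)

  ⟦mapBits⟧ : (F : Bits m → Bits n) (L : Store m) (y : Fin n) (e : D) →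
    ⟦ mapBits F L ⟧ y e ⇔ Any (λ p → e ≡ proj₁ p × F (proj₂ p) y ≡ true) L
  ⟦mapBits⟧ F L y e = mk⇔ map⁻ map⁺

  ⟦mapBits-image⟧ : (ρ : BoolRel m) (L : Store m) (y : Fin m) (e : D) →
    ⟦ mapBits (image ρ) L ⟧ y e ⇔ (∃[ x ] (ρ x y ≡ true × ⟦ L ⟧ x e))
  ⟦mapBits-image⟧ ρ L y e = mk⇔ (to′ L ∘ map⁻) (map⁺ ∘ from′)
    where
    to′ : ∀ L → Any (λ p → e ≡ proj₁ p × image ρ (proj₂ p) y ≡ true) L →
          ∃[ x ] (ρ x y ≡ true × ⟦ L ⟧ x e)
    to′ (_ ∷ _) (here (e≡ , im)) =
      let (x , cx , r) = to (image-true ρ _ y) im in x , r , here (e≡ , cx)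
    to′ (_ ∷ L) (there s) = let (x , r , s′) = to′ L s in x , r , there s′
    from′ : ∃[ x ] (ρ x y ≡ true × ⟦ L ⟧ x e) →
            Any (λ p → e ≡ proj₁ p × image ρ (proj₂ p) y ≡ true) L
    from′ (x , r , s) = Any.map (λ (e≡ , cx) → e≡ , from (image-true ρ _ y) (x , cx , r)) s

  ∉-─ : ∀ {d} {L : Store m} → Distinct L → (a : d ∈ˢ L) → ¬ d ∈ˢ (L ─ a)
  ∉-─ (ds ∷ _) (here d≡)          = All¬⇒¬Any (All.map (λ ne → ne ∘ trans (sym d≡)) ds)
  ∉-─ (ds ∷ _) (there a) (here d≡) = All¬⇒¬Any (All.map (λ ne → ne ∘ trans (sym d≡)) ds) a
  ∉-─ (_ ∷ ds) (there a) (there b) = ∉-─ ds a b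

  Any-at : ∀ {d} {L : Store m} {Q : Entry m → Set} → Distinct L → (a : d ∈ˢ L) →
    Any (λ p → d ≡ proj₁ p × Q p) L ⇔ Q (Any.lookup a)
  Any-at ds a = mk⇔
    (λ s → [ proj₂ , (λ s′ → ⊥-elim (∉-─ ds a (Any.map proj₁ s′))) ]′ (to (Any-─ a) s))
    (λ q → from (Any-─ a) (inj₁ (lookup-result a , q)))

  CharVec : (Fin m → D → Set) → D → Bits m → Set
  CharVec X d z = ∀ y → z y ≡ true ⇔ X y d

  BitsInvariant : (Entry m → Set) → Set
  BitsInvariant G = ∀ {e c c′} → c ≗ c′ → G (e , c) → G (e , c′)

  record Split (L : Store m) (d : D) (z : Bits m) : Set₁ where
    field
      rest          : Store m
      d∉rest        : ¬ d ∈ˢ rest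
      rest-distinct : Distinct rest
      rest-All      : ∀ {P : Entry m → Set} → All P L → All P rest
      -- d occurs in L, with a vector pointwise equal to z, exactly when z is nonzero.
      split         : ∀ {G} → BitsInvariant G → Any G L ⇔ ((Nonzero z × G (d , z)) ⊎ Any G rest)

  splitAt : ∀ {L : Store m} {d z} → Distinct L → All (Nonzero ∘ proj₂) L →
    CharVec ⟦ L ⟧ d z → Split L d z
  splitAt {L = L} {d} {z} ds nz cv with nonzero? z
  ... | yes (y , zy) = record
    { rest = L ─ a ; d∉rest = ∉-─ ds a ; rest-distinct = AllPairs-─ a ds ; rest-All = ─⁺ a
    ; split = λ {G} inv → ⇔.trans (Any-─ a) (at-d {G} inv ⊎-⇔ ⇔.refl) }
    where
    a : d ∈ˢ L
    a = Any.map proj₁ (to (cv y) zy)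
    entry≗z : proj₂ (Any.lookup a) ≗ z
    entry≗z y′ = bool-ext (⇔.trans (⇔.sym (Any-at ds a)) (⇔.sym (cv y′)))
    at-d : ∀ {G} → BitsInvariant G → G (Any.lookup a) ⇔ (Nonzero z × G (d , z))
    at-d {G} inv = mk⇔
      (λ g → (y , zy) , subst (λ e → G (e , z)) (sym (lookup-result a)) (inv entry≗z g))
      (λ (_ , g) → inv {proj₁ (Any.lookup a)} (sym ∘ entry≗z)
                         (subst (λ e → G (e , z)) (lookup-result a) g))
  ... | no ¬nonzero = record
    { rest = L ; d∉rest = d∉L ; rest-distinct = ds ; rest-All = λ ps → ps
    ; split = λ _ → mk⇔ inj₂ [ ⊥-elim ∘ ¬nonzero ∘ proj₁ , (λ g → g) ]′ }
    where
    d∉L : ¬ d ∈ˢ L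
    d∉L a = let ((y , cy) , _) = All.lookupAny nz a in ¬nonzero (y , from (cv y) (from (Any-at ds a) cy))

  AfterUpdate : (Fin m → D → Set) → BoolRel m → (u v : Bits m) → D → Fin m → D → Set
  AfterUpdate X ρ u v d y e =
    ((∃[ x ] (ρ x y ≡ true × X x e)) ⊎ (u y ≡ true × e ≡ d)) × ¬ (v y ≡ true × e ≡ d)

  ⟦⟧-update : ∀ {X : Fin m → D → Set} {K d z} (ρ : BoolRel m) (u v : Bits m) →
    (∀ y e → X y e ⇔ ((e ≡ d × z y ≡ true) ⊎ ⟦ K ⟧ y e)) → ¬ d ∈ˢ K →
    ∀ y e → ⟦ (d , updated ρ z u v) ∷ mapBits (image ρ) K ⟧ y e ⇔ AfterUpdate X ρ u v d y e
  ⟦⟧-update {X = X} {K} {d} {z} ρ u v X⇔ d∉K y e = mk⇔ to′ from′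
    where
    to′ : ⟦ (d , updated ρ z u v) ∷ mapBits (image ρ) K ⟧ y e → AfterUpdate X ρ u v d y e
    to′ (here (e≡d , upd)) with to (updated-true ρ z u v y) upd
    ... | inj₁ im , ¬v = let (x , zx , r) = to (image-true ρ z y) im
                         in inj₁ (x , r , from (X⇔ x e) (inj₁ (e≡d , zx))) , λ (v , _) → ¬v v
    ... | inj₂ uy , ¬v = inj₂ (uy , e≡d) , λ (v , _) → ¬v v
    to′ (there s) = let (x , r , sK) = to (⟦mapBits-image⟧ ρ K y e) s
                    in inj₁ (x , r , from (X⇔ x e) (inj₂ sK))
                     , λ (_ , e≡d) → d∉K (Any.map (λ (e≡ , _) → trans (sym e≡d) e≡) sK)
    from′ : AfterUpdate X ρ u v d y e → ⟦ (d , updated ρ z u v) ∷ mapBits (image ρ) K ⟧ y e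
    from′ (inj₁ (x , r , Xxe) , ¬vd) with to (X⇔ x e) Xxe
    ... | inj₁ (e≡d , zx) = here (e≡d , from (updated-true ρ z u v y)
                                   (inj₁ (from (image-true ρ z y) (x , zx , r)) , λ v → ¬vd (v , e≡d)))
    ... | inj₂ sK = there (from (⟦mapBits-image⟧ ρ K y e) (x , r , sK))
    from′ (inj₂ (uy , e≡d) , ¬vd) =
      here (e≡d , from (updated-true ρ z u v y) (inj₂ uy , λ v → ¬vd (v , e≡d)))

  ⟦∷⟧-cong : ∀ {d} {c c′ : Bits m} {K K′ : Store m} →
    c ≗ c′ → (∀ y e → ⟦ K ⟧ y e ⇔ ⟦ K′ ⟧ y e) →
    ∀ y e → ⟦ (d , c) ∷ K ⟧ y e ⇔ ⟦ (d , c′) ∷ K′ ⟧ y e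
  ⟦∷⟧-cong c≗c′ K⇔K′ y e = mk⇔
    (λ { (here (e≡ , cy)) → here (e≡ , to (≗⇒⇔ c≗c′ y) cy)
       ; (there s)        → there (to (K⇔K′ y e) s) })
    (λ { (here (e≡ , cy)) → here (e≡ , from (≗⇒⇔ c≗c′ y) cy)
       ; (there s)        → there (from (K⇔K′ y e) s) })

  ⟦mapBits⟧-cong : ∀ {F G : Bits m → Bits n} {L : Store m} →
    All (λ p → F (proj₂ p) ≗ G (proj₂ p)) L → ∀ y e → ⟦ mapBits F L ⟧ y e ⇔ ⟦ mapBits G L ⟧ y e
  ⟦mapBits⟧-cong []           y e = mk⇔ (λ ()) (λ ())
  ⟦mapBits⟧-cong (F≗G ∷ F≗Gs) = ⟦∷⟧-cong F≗G (⟦mapBits⟧-cong F≗Gs)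

  ⟦mapBits∘mapBits⟧ : ∀ {k} (F : Bits m → Bits n) (G : Bits n → Bits k) (L : Store m) y e →
    ⟦ mapBits G (mapBits F L) ⟧ y e ⇔ ⟦ mapBits (G ∘ F) L ⟧ y e
  ⟦mapBits∘mapBits⟧ F G L y e = mk⇔ (map⁺ ∘ map⁻ ∘ map⁻) (map⁺ ∘ map⁺ ∘ map⁻)

  ∉-mapBits : ∀ {d} {F : Bits m → Bits n} {L : Store m} → ¬ d ∈ˢ L → ¬ d ∈ˢ mapBits F L
  ∉-mapBits d∉L = d∉L ∘ map⁻

  encodeStore : Store m → Store (2 ^ m)
  encodeStore = mapBits (⁅_⁆ ∘ encode)

  ⟦encodeStore⟧ : (L : Store m) (j : Fin (2 ^ m)) (e : D) →
    ⟦ encodeStore L ⟧ j e ⇔ Any (λ p → e ≡ proj₁ p × encode (proj₂ p) ≡ j) L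
  ⟦encodeStore⟧ L j e = ⇔.trans (⟦mapBits⟧ (⁅_⁆ ∘ encode) L j e)
    (mk⇔ (Any.map (map₂ (to (⁅⁆-true _ j)))) (Any.map (map₂ (from (⁅⁆-true _ j)))))

  module _ {L : Store m} {d : D} {z : Bits m} (S : Split L d z) where
    open Split S

    ⟦⟧-split : ∀ y e → ⟦ L ⟧ y e ⇔ ((e ≡ d × z y ≡ true) ⊎ ⟦ rest ⟧ y e)
    ⟦⟧-split y e = ⇔.trans (split λ c≗c′ (e≡ , cy) → e≡ , to (≗⇒⇔ c≗c′ y) cy)
      (mk⇔ proj₂ (λ (e≡d , zy) → (y , zy) , e≡d , zy) ⊎-⇔ ⇔.refl)

    ⟦encodeStore⟧-split : ∀ j e →
      ⟦ encodeStore L ⟧ j e ⇔ ((e ≡ d × encodedChar z j ≡ true) ⊎ ⟦ encodeStore rest ⟧ j e)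
    ⟦encodeStore⟧-split j e = ⇔.trans (⟦encodeStore⟧ L j e) (⇔.trans
      (split λ c≗c′ (e≡ , c≡j) → e≡ , trans (sym (encode-cong c≗c′)) c≡j)
      (mk⇔ (λ (nz , e≡d , z≡j) → e≡d , from (encodedChar-true z j) (nz , z≡j))
           (λ (e≡d , zj) → let (nz , z≡j) = to (encodedChar-true z j) zj in nz , e≡d , z≡j)
       ⊎-⇔ ⇔.sym (⟦encodeStore⟧ rest j e)))

  CharVec-split : ∀ {X : Fin m → D → Set} {K : Store m} {d z} →
    (∀ y e → X y e ⇔ ((e ≡ d × z y ≡ true) ⊎ ⟦ K ⟧ y e)) → ¬ d ∈ˢ K → CharVec X d z
  CharVec-split X⇔ d∉K y = mk⇔ (λ zy → from (X⇔ y _) (inj₁ (refl , zy)))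
    (λ Xyd → [ proj₂ , (λ s → ⊥-elim (d∉K (Any.map proj₁ s))) ]′ (to (X⇔ y _) Xyd))

  CharVec-encode : ∀ {L : Store m} {d z} → Distinct L → All (Nonzero ∘ proj₂) L →
    CharVec ⟦ L ⟧ d z ⇔ CharVec ⟦ encodeStore L ⟧ d (encodedChar z)
  CharVec-encode {L = L} {d} {z} ds nz = mk⇔ encodeChar decodeChar
    where
    encodeChar : CharVec ⟦ L ⟧ d z → CharVec ⟦ encodeStore L ⟧ d (encodedChar z)
    encodeChar cv =
      let S = splitAt ds nz cv in CharVec-split (⟦encodeStore⟧-split S) (∉-mapBits (Split.d∉rest S))
    decodeChar : CharVec ⟦ encodeStore L ⟧ d (encodedChar z) → CharVec ⟦ L ⟧ d z
    decodeChar cvB = by-cases (nonzero? z)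
      where
      by-cases : Dec (Nonzero z) → CharVec ⟦ L ⟧ d z
      by-cases (yes z≢0) y = ⇔.trans (≗⇒⇔ (sym ∘ entry≗z) y) (⇔.sym (Any-at ds a))
        where
        s : Any (λ p → d ≡ proj₁ p × encode (proj₂ p) ≡ encode z) L
        s = to (⟦encodeStore⟧ L (encode z) d)
               (to (cvB (encode z)) (from (encodedChar-true z _) (z≢0 , refl)))
        a : d ∈ˢ L
        a = Any.map proj₁ s
        entry≗z : proj₂ (Any.lookup a) ≗ z
        entry≗z = encode-injective (to (Any-at ds a) s)
      by-cases (no z≡0) y = mk⇔ (λ zy → ⊥-elim (z≡0 (y , zy))) λ s →
        let a = Any.map proj₁ s
            j = encode (proj₂ (Any.lookup a))
            stored = from (⟦encodeStore⟧ L j d) (from (Any-at ds a) refl)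
        in ⊥-elim (z≡0 (proj₁ (to (encodedChar-true z j) (from (cvB j) stored))))

  CharsIn : List (Bits m) → (Fin m → D → Set) → Set
  CharsIn C X = ∀ d → (∃[ y ] X y d) → ∃[ c ] (c ∈ C × CharVec X d c)

  CharsIn-cong : ∀ {C : List (Bits m)} {X X′ : Fin m → D → Set} →
    (∀ y e → X y e ⇔ X′ y e) → CharsIn C X → CharsIn C X′
  CharsIn-cong X⇔X′ chars d (y , X′yd) =
    let (c , c∈C , cv) = chars d (y , from (X⇔X′ y d) X′yd)
    in c , c∈C , λ y′ → ⇔.trans (cv y′) (X⇔X′ y′ d)

  encodedChar-nonzero : {z : Bits m} → Nonzero z →
    ∀ j → encodedChar z j ≡ true ⇔ ⁅ encode z ⁆ j ≡ true
  encodedChar-nonzero {z = z} nz j =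
    ⇔.trans (encodedChar-true z j) (⇔.trans (mk⇔ proj₂ (nz ,_)) (⇔.sym (⁅⁆-true (encode z) j)))

  CharsIn-encode : ∀ {C : List (Bits m)} {L : Store m} → Distinct L → All (Nonzero ∘ proj₂) L →
    CharsIn C ⟦ L ⟧ ⇔ CharsIn (map (⁅_⁆ ∘ encode) C) ⟦ encodeStore L ⟧
  CharsIn-encode {C = C} {L} ds nz = mk⇔ encodeChars decodeChars
    where
    encodeChars : CharsIn C ⟦ L ⟧ → CharsIn (map (⁅_⁆ ∘ encode) C) ⟦ encodeStore L ⟧
    encodeChars chars d (j , s) =
      let a = Any.map proj₁ (to (⟦encodeStore⟧ L j d) s)
          ((y , cy) , _) = All.lookupAny nz a
          (c , c∈C , cv) = chars d (y , from (Any-at ds a) cy)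
          cvB = to (CharVec-encode ds nz) cv
      in ⁅ encode c ⁆ , ∈-map⁺ (⁅_⁆ ∘ encode) c∈C ,
         λ j′ → ⇔.trans (⇔.sym (encodedChar-nonzero (y , from (cv y) (from (Any-at ds a) cy)) j′))
                        (cvB j′)
    decodeChars : CharsIn (map (⁅_⁆ ∘ encode) C) ⟦ encodeStore L ⟧ → CharsIn C ⟦ L ⟧
    decodeChars chars d (y , s) with Any.map proj₁ s
    ... | a with chars d (encode (proj₂ (Any.lookup a)) ,
                          from (⟦encodeStore⟧ L _ d) (from (Any-at ds a) refl))
    ... | cB , cB∈ , cvB with ∈-map⁻ (⁅_⁆ ∘ encode) cB∈
    ... | c , c∈C , refl = c , c∈C , from (CharVec-encode ds nz) λ j →
      ⇔.trans (encodedChar-nonzero c≢0 j) (cvB j)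
      where
      c≗entry : c ≗ proj₂ (Any.lookup a)
      c≗entry = encode-injective (to (⁅⁆-true (encode c) _)
                  (from (cvB _) (from (⟦encodeStore⟧ L _ d) (from (Any-at ds a) refl))))
      c≢0 : Nonzero c
      c≢0 = y , from (≗⇒⇔ c≗entry y) (to (Any-at ds a) s)

module RestrictedTo {nΣ : ℕ} (A : SetAutomaton nΣ) (P : Fin (SetAutomaton.nY A) → Set) where
  open SetAutomaton A
  open Transition
  open Structure.On A P

  IsUnit-cong : {c c′ : Bits nY} → (∀ y → P y → c y ≡ true ⇔ c′ y ≡ true) → IsUnit c → IsUnit c′
  IsUnit-cong c⇔c′ (y , py , cy , unique) =
    y , py , to (c⇔c′ y py) cy , λ y′ py′ c′y′ → unique y′ py′ (from (c⇔c′ y′ py′) c′y′)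

  Subsingleton : (Fin nY → Set) → Set
  Subsingleton S = ∀ {x y} → P x → P y → S x → S y → x ≡ y

  UpdatePartition : (Fin nY → ℕ) → Transition nΣ nQ nY → Set
  UpdatePartition rank t =
    Σ (Fin nY → Bool) λ side → (
      (∀ x y → P x → P y → ¬ Bounded x → ¬ Bounded y →
         side x ≡ false → side y ≡ true → rank x < rank y) ×
      (∀ x y → P x → P y → ¬ Bounded x → side x ≡ false →
         rho t x y ≡ true → (¬ Bounded y × side y ≡ true)) ×
      (∀ x → P x → ¬ Bounded x → side x ≡ true →
         rho t x x ≡ true × (∀ y → P y → rho t x y ≡ true → y ≡ x)))

  updated⇔uvec : ∀ {t} → NormalTransition t → (∀ {x y} → rho t x y ≡ true → P y → P x) →
    Subsingleton (Img (rho t) (zvec t)) →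
    ∀ y → P y → updated (rho t) (zvec t) (uvec t) (vvec t) y ≡ true ⇔ uvec t y ≡ true
  updated⇔uvec {t} (_ , (_ , _ , _ , u-unique) , v≐Img , v≐0) P-closed Img-single y py = mk⇔ ⇒ ⇐
    where
    u≐Img : Img (rho t) (zvec t) y → uvec t y ≡ true → EqImg (uvec t) (rho t) (zvec t)
    u≐Img img uy y′ py′ = mk⇔
      (λ uy′ → subst (Img (rho t) (zvec t)) (trans (u-unique y py uy) (sym (u-unique y′ py′ uy′))) img)
      (λ img′ → subst (λ w → uvec t w ≡ true) (Img-single py py′ img img′) uy)
    ⇒ : updated (rho t) (zvec t) (uvec t) (vvec t) y ≡ true → uvec t y ≡ true
    ⇒ upd with to (updated-true (rho t) (zvec t) (uvec t) (vvec t) y) upd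
    ... | inj₂ uy , _  = uy
    ... | inj₁ im , ¬v =
      let (x , zx , r) = to (image-true (rho t) (zvec t) y) im
          img = x , P-closed r py , zx , r
      -- EqImg need not be decided: it and its negation both refute ¬ u y.
      in decidable-stable (uvec t y ≟ᵇ true) λ ¬u →
           (λ ¬eq → ¬v (from (v≐Img ¬eq y py) img)) (λ eq → ¬u (from (eq y py) img))
    ⇐ : uvec t y ≡ true → updated (rho t) (zvec t) (uvec t) (vvec t) y ≡ true
    ⇐ uy = from (updated-true (rho t) (zvec t) (uvec t) (vvec t) y) (inj₂ uy , λ vy →
      (λ ¬eq → ¬eq (u≐Img (to (v≐Img ¬eq y py) vy) uy))
      (λ eq → true≢false (trans (sym vy) (v≐0 eq y py))))

module Normalisation {nΣ : ℕ} (A : SetAutomaton nΣ) where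
  open SetAutomaton A
  open Transition
  open Structure A
  open Structure.On A NonStable
  open RestrictedTo A NonStable

  stable? : (y : Fin nY) → Dec (Stable y)
  stable? y = map′ (λ all t t∈ → All.lookup all t∈) (λ st → All.tabulate (λ {t} t∈ → st t t∈))
    (All.all? (λ t → all? λ x → ((rho t y x ≟ᵇ true) ⇔-dec (x ≟ y)) ×-dec
                                 ((rho t x y ≟ᵇ true) ⇔-dec (x ≟ y))) Δ)

  nonStable? : (y : Fin nY) → Dec (NonStable y)
  nonStable? y = ¬? (stable? y)

  isUnit? : (c : Bits nY) → Dec (IsUnit c)
  isUnit? c = any? λ y → nonStable? y ×-dec (c y ≟ᵇ true) ×-dec
                          all? (λ y′ → nonStable? y′ →-dec ((c y′ ≟ᵇ true) →-dec (y′ ≟ y)))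

  IsUnit⇒Nonzero : {c : Bits nY} → IsUnit c → Nonzero c
  IsUnit⇒Nonzero (y , _ , cy , _) = y , cy

  name : {c : Bits nY} → IsUnit c → Fin nY
  name = proj₁

  name-nonStable : {c : Bits nY} (g : IsUnit c) → NonStable (name g)
  name-nonStable (_ , py , _) = py

  name-true : {c : Bits nY} (g : IsUnit c) → c (name g) ≡ true
  name-true (_ , _ , cy , _) = cy

  IsUnit-unique : {c : Bits nY} (g : IsUnit c) {y : Fin nY} → NonStable y → c y ≡ true → y ≡ name g
  IsUnit-unique (_ , _ , _ , unique) py cy = unique _ py cy

  module _ {t : Transition nΣ nQ nY} (t∈ : t ∈ Δ) where

    stable-successor : ∀ {x y} → Stable x → rho t x y ≡ true → y ≡ x
    stable-successor {y = y} st r = to (proj₁ (st t t∈ y)) r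

    stable-predecessor : ∀ {x y} → Stable y → rho t x y ≡ true → x ≡ y
    stable-predecessor {x} st r = to (proj₂ (st t t∈ x)) r

    nonStable-predecessor : ∀ {x y} → rho t x y ≡ true → NonStable y → NonStable x
    nonStable-predecessor r ns st = ns (subst Stable (sym (stable-successor st r)) st)

    nonStable-successor : ∀ {x y} → rho t x y ≡ true → NonStable x → NonStable y
    nonStable-successor r ns st = ns (subst Stable (sym (stable-predecessor st r)) st)

    image-unit-edge : ∀ {c y} (g : IsUnit c) → NonStable y →
      image (rho t) c y ≡ true → rho t (name g) y ≡ true
    image-unit-edge {c} {y} g py im =
      let (x , cx , r) = to (image-true (rho t) c y) im
      in subst (λ w → rho t w y ≡ true) (IsUnit-unique g (nonStable-predecessor r py) cx) r

    module _ (normal : Normal) where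

      successor : ∀ {x} → NonStable x →
        ∃[ y ] (NonStable y × rho t x y ≡ true × (∀ y′ → NonStable y′ → rho t x y′ ≡ true → y′ ≡ y))
      successor = proj₁ (normal t t∈) _

      uvec-IsUnit : IsUnit (uvec t)
      uvec-IsUnit = proj₁ (proj₂ (normal t t∈))

      successor-unique : ∀ {x y y′} → NonStable x → rho t x y ≡ true → rho t x y′ ≡ true → y ≡ y′
      successor-unique px r r′ =
        let (_ , _ , _ , unique) = successor px
        in trans (unique _ (nonStable-successor r px) r) (sym (unique _ (nonStable-successor r′ px) r′))

      image-IsUnit : {c : Bits nY} → IsUnit c → IsUnit (image (rho t) c)
      image-IsUnit {c} g =
        let (y , py , r , _) = successor (name-nonStable g)
        in y , py , from (image-true (rho t) c y) (name g , name-true g , r) ,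
           λ y′ py′ im → successor-unique (name-nonStable g) (image-unit-edge g py′ im) r

      Img-subsingleton : {z : Bits nY} → IsUnit z ⊎ ¬ Nonzero z → Subsingleton (Img (rho t) z)
      Img-subsingleton (inj₁ g) _ _ (x , px , zx , r) (x′ , px′ , zx′ , r′) =
        successor-unique (name-nonStable g)
          (subst (λ w → rho t w _ ≡ true) (IsUnit-unique g px zx) r)
          (subst (λ w → rho t w _ ≡ true) (IsUnit-unique g px′ zx′) r′)
      Img-subsingleton (inj₂ z≡0) _ _ (x , _ , zx , _) _ = ⊥-elim (z≡0 (x , zx))

      updated-IsUnit : IsUnit (zvec t) ⊎ ¬ Nonzero (zvec t) →
        IsUnit (updated (rho t) (zvec t) (uvec t) (vvec t))
      updated-IsUnit z-shape = IsUnit-cong (λ y py → ⇔.sym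
        (updated⇔uvec {t} (normal t t∈) nonStable-predecessor (Img-subsingleton z-shape) y py)) uvec-IsUnit

  N : ℕ
  N = 2 ^ nY

  follow : Transition nΣ nQ nY → Fin N → Fin N
  follow t i with isUnit? (decode i)
  ... | yes _ = encode (image (rho t) (decode i))
  -- Improper names hold no data; sending them to a proper name keeps every update target proper.
  ... | no  _ = encode (uvec t)

  newName : Transition nΣ nQ nY → Fin N
  newName t = encode (updated (rho t) (zvec t) (uvec t) (vvec t))

  -- Normality asks for v = ρ[z] if ρ[z] ≠ u and v = 0 otherwise; here ρ[z] is {follow t (encode z)} or ∅.
  removed? : (t : Transition nΣ nQ nY) (j : Fin N) →
    Dec (Nonzero (zvec t) × follow t (encode (zvec t)) ≡ j × follow t (encode (zvec t)) ≢ newName t)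
  removed? t j =
    nonzero? (zvec t) ×-dec (follow t (encode (zvec t)) ≟ j) ×-dec ¬? (follow t (encode (zvec t)) ≟ newName t)

  normalise : Transition nΣ nQ nY → Transition nΣ nQ N
  normalise t = record
    { src = src t ; letter = letter t ; zvec = encodedChar (zvec t) ; rho = ⁅_⁆ ∘ follow t
    ; uvec = ⁅ newName t ⁆ ; vvec = does ∘ removed? t ; tgt = tgt t }

  B : SetAutomaton nΣ
  B = record { nQ = nQ ; nY = N ; Δ = map normalise Δ ; I = I ; F = F ; C = map (⁅_⁆ ∘ encode) C }

  module NB = Structure.On B (Structure.AllNames B)
  module RB = RestrictedTo B (Structure.AllNames B)

  Img-normalise : (t : Transition nΣ nQ nY) (j : Fin N) →
    NB.Img (rho (normalise t)) (zvec (normalise t)) j ⇔ (Nonzero (zvec t) × follow t (encode (zvec t)) ≡ j)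
  Img-normalise t j = mk⇔
    (λ (i , _ , zi , r) → let (nz , z≡i) = to (encodedChar-true (zvec t) i) zi
                          in nz , trans (cong (follow t) z≡i) (to (⁅⁆-true _ j) r))
    (λ (nz , f≡j) → encode (zvec t) , tt , from (encodedChar-true (zvec t) _) (nz , refl) ,
                    from (⁅⁆-true _ j) f≡j)

  ⁅⁆-IsUnit : (k : Fin N) → NB.IsUnit ⁅ k ⁆
  ⁅⁆-IsUnit k = k , tt , from (⁅⁆-true k k) refl , λ j _ r → sym (to (⁅⁆-true k j) r)

  normalise-normal : (t : Transition nΣ nQ nY) → NB.NormalTransition (normalise t)
  normalise-normal t = (λ i _ → ⁅⁆-IsUnit (follow t i)) , ⁅⁆-IsUnit (newName t) , v≐Img , v≐0
    where
    ρz : Fin N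
    ρz = follow t (encode (zvec t))
    EqImg-normalise : Set
    EqImg-normalise = NB.EqImg ⁅ newName t ⁆ (⁅_⁆ ∘ follow t) (encodedChar (zvec t))
    EqImg-if : Nonzero (zvec t) → ρz ≡ newName t → EqImg-normalise
    EqImg-if nz ρz≡new j _ = ⇔.trans (⁅⁆-true _ j) (⇔.trans
      (mk⇔ (λ new≡j → nz , trans ρz≡new new≡j) (λ (_ , ρz≡j) → trans (sym ρz≡new) ρz≡j))
      (⇔.sym (Img-normalise t j)))
    v≐Img : ¬ EqImg-normalise →
      ∀ j → ⊤ → does (removed? t j) ≡ true ⇔ NB.Img (⁅_⁆ ∘ follow t) (encodedChar (zvec t)) j
    v≐Img ¬eq j _ = ⇔.trans (does⇔ (removed? t j)) (⇔.trans
      (mk⇔ (λ (nz , ρz≡j , _) → nz , ρz≡j)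
           (λ (nz , ρz≡j) → nz , ρz≡j , λ ρz≡new → ¬eq (EqImg-if nz ρz≡new)))
      (⇔.sym (Img-normalise t j)))
    v≐0 : EqImg-normalise → ∀ j → ⊤ → does (removed? t j) ≡ false
    v≐0 eq j _ = dec-false (removed? t j) λ (_ , _ , ρz≢new) →
      ρz≢new (proj₂ (to (Img-normalise t (newName t))
                        (to (eq (newName t) tt) (from (⁅⁆-true (newName t) _) refl))))

  B-normal : NB.Normal
  B-normal t′ t′∈ with ∈-map⁻ normalise t′∈
  ... | t , _ , refl = normalise-normal t

  updated-normalise : (t : Transition nΣ nQ nY) →
    updated (⁅_⁆ ∘ follow t) (encodedChar (zvec t)) ⁅ newName t ⁆ (does ∘ removed? t) ≗ ⁅ newName t ⁆
  updated-normalise t j =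
    bool-ext (RB.updated⇔uvec {normalise t} (normalise-normal t) (λ _ _ → tt) Img-single j tt)
    where
    Img-single : RB.Subsingleton (NB.Img (⁅_⁆ ∘ follow t) (encodedChar (zvec t)))
    Img-single {x} {y} _ _ img img′ =
      trans (sym (proj₂ (to (Img-normalise t x) img))) (proj₂ (to (Img-normalise t y) img′))

  IsUnit-decode-encode : {c : Bits nY} → IsUnit c → IsUnit (decode (encode c))
  IsUnit-decode-encode {c} = IsUnit-cong (λ y _ → ≗⇒⇔ (sym ∘ decode-encode c) y)

  follow-proper : ∀ t {i} → IsUnit (decode i) → follow t i ≡ encode (image (rho t) (decode i))
  follow-proper t {i} g with isUnit? (decode i)
  ... | yes _ = refl
  ... | no ¬g = ⊥-elim (¬g g)

  follow-encode : ∀ t {c} → IsUnit c → follow t (encode c) ≡ encode (image (rho t) c)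
  follow-encode t {c} g =
    trans (follow-proper t (IsUnit-decode-encode g)) (encode-cong (image-cong (rho t) (decode-encode c)))

  module Simulation (D : Set) (normal : Normal) where
    open Stores D
    module SA = Semantics D A
    module SB = Semantics D B

    WellFormed : Store nY → Set
    WellFormed L = Distinct L × All (IsUnit ∘ proj₂) L

    entries-nonzero : ∀ {L} → WellFormed L → All (Nonzero ∘ proj₂) L
    entries-nonzero = All.map IsUnit⇒Nonzero ∘ proj₂

    module StepCorrespondence {t : Transition nΣ nQ nY} (t∈ : t ∈ Δ) {L : Store nY} (wf : WellFormed L)
                              {d : D} (cv : CharVec ⟦ L ⟧ d (zvec t)) where
      S : Split L d (zvec t)
      S = splitAt (proj₁ wf) (entries-nonzero wf) cv
      open Split S

      next : Store nY
      next = (d , updated (rho t) (zvec t) (uvec t) (vvec t)) ∷ mapBits (image (rho t)) rest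

      z-shape : IsUnit (zvec t) ⊎ ¬ Nonzero (zvec t)
      z-shape = by-cases (nonzero? (zvec t))
        where
        by-cases : Dec (Nonzero (zvec t)) → IsUnit (zvec t) ⊎ ¬ Nonzero (zvec t)
        by-cases (no z≡0) = inj₂ z≡0
        by-cases (yes z≢0) = inj₁ (All.lookupWith {R = λ _ → IsUnit (zvec t)}
          (λ isUnit c≗z → IsUnit-cong (λ y _ → ≗⇒⇔ c≗z y) isUnit) (proj₂ wf)
          (from (split (λ c≗c′ c≗z y → trans (sym (c≗c′ y)) (c≗z y))) (inj₁ (z≢0 , λ _ → refl))))

      next-wellFormed : WellFormed next
      next-wellFormed =
        (map⁺ᴬ (¬Any⇒All¬ rest d∉rest) ∷ map⁺ᴬᴾ rest-distinct) ,
        (updated-IsUnit t∈ normal z-shape ∷ map⁺ᴬ (All.map (image-IsUnit t∈ normal) (rest-All (proj₂ wf))))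

      charB : CharVec ⟦ encodeStore L ⟧ d (encodedChar (zvec t))
      charB = to (CharVec-encode (proj₁ wf) (entries-nonzero wf)) cv

      next-A : ∀ {X} → (∀ y e → X y e ⇔ ⟦ L ⟧ y e) →
        ∀ y e → ⟦ next ⟧ y e ⇔ AfterUpdate X (rho t) (uvec t) (vvec t) d y e
      next-A X⇔ = ⟦⟧-update (rho t) (uvec t) (vvec t) (λ y e → ⇔.trans (X⇔ y e) (⟦⟧-split S y e)) d∉rest

      encode-next : ∀ j e → ⟦ encodeStore next ⟧ j e ⇔
        ⟦ (d , updated (⁅_⁆ ∘ follow t) (encodedChar (zvec t)) ⁅ newName t ⁆ (does ∘ removed? t))
            ∷ mapBits (image (⁅_⁆ ∘ follow t)) (encodeStore rest) ⟧ j e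
      encode-next = ⟦∷⟧-cong (sym ∘ updated-normalise t) λ j e →
        ⇔.trans (⟦mapBits∘mapBits⟧ (image (rho t)) (⁅_⁆ ∘ encode) rest j e) (⇔.trans
          (⟦mapBits⟧-cong (All.map follow-image (rest-All (proj₂ wf))) j e)
          (⇔.sym (⟦mapBits∘mapBits⟧ (⁅_⁆ ∘ encode) (image (⁅_⁆ ∘ follow t)) rest j e)))
        where
        follow-image : {c : Bits nY} → IsUnit c →
          ⁅ encode (image (rho t) c) ⁆ ≗ image (⁅_⁆ ∘ follow t) ⁅ encode c ⁆
        follow-image {c} g j =
          trans (cong (λ k → ⁅ k ⁆ j) (sym (follow-encode t g))) (sym (image-⁅⁆ (follow t) (encode c) j))

      next-B : ∀ {XB} → (∀ j e → XB j e ⇔ ⟦ encodeStore L ⟧ j e) →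
        ∀ j e → ⟦ encodeStore next ⟧ j e ⇔
                AfterUpdate XB (⁅_⁆ ∘ follow t) ⁅ newName t ⁆ (does ∘ removed? t) d j e
      next-B XB⇔ j e = ⇔.trans (encode-next j e)
        (⟦⟧-update (⁅_⁆ ∘ follow t) ⁅ newName t ⁆ (does ∘ removed? t)
          (λ j e → ⇔.trans (XB⇔ j e) (⟦encodeStore⟧-split S j e)) (∉-mapBits d∉rest) j e)

    simulate-A : ∀ {q X w c′} → SA.Run (q , X) w c′ → SA.Accepting c′ →
      ∀ {L} → WellFormed L → (∀ y e → X y e ⇔ ⟦ L ⟧ y e) →
      ∃[ c″ ] (SB.Run (q , ⟦ encodeStore L ⟧) w c″ × SB.Accepting c″)
    simulate-A SA.done (fq , chars) wf X⇔ =
      _ , SB.done , fq , to (CharsIn-encode (proj₁ wf) (entries-nonzero wf)) (CharsIn-cong X⇔ chars)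
    simulate-A (SA.step (t , t∈ , src≡ , letter≡ , cv , tgt≡ , X″⇔) run) acc wf X⇔ =
      let open StepCorrespondence t∈ wf (λ y → ⇔.trans (cv y) (X⇔ y _))
          (c″ , runB , accB) = simulate-A run acc next-wellFormed λ y e →
                                 ⇔.trans (X″⇔ y e) (⇔.sym (next-A X⇔ y e))
          stepB = normalise t , ∈-map⁺ normalise t∈ , src≡ , letter≡ , charB , tgt≡ ,
                  next-B (λ _ _ → ⇔.refl)
      in c″ , SB.step stepB runB , accB

    simulate-B : ∀ {q XB w c′} → SB.Run (q , XB) w c′ → SB.Accepting c′ →
      ∀ {L} → WellFormed L → (∀ j e → XB j e ⇔ ⟦ encodeStore L ⟧ j e) →
      ∃[ c″ ] (SA.Run (q , ⟦ L ⟧) w c″ × SA.Accepting c″)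
    simulate-B SB.done (fq , chars) wf XB⇔ =
      _ , SA.done , fq , from (CharsIn-encode (proj₁ wf) (entries-nonzero wf)) (CharsIn-cong XB⇔ chars)
    simulate-B (SB.step (t′ , t′∈ , src≡ , letter≡ , cvB , tgt≡ , XB″⇔) run) acc wf XB⇔
      with ∈-map⁻ normalise t′∈
    ... | t , t∈ , refl =
      let cv = from (CharVec-encode (proj₁ wf) (entries-nonzero wf)) λ j → ⇔.trans (cvB j) (XB⇔ j _)
          open StepCorrespondence t∈ wf cv
          (c″ , runA , accA) = simulate-B run acc next-wellFormed λ j e →
                                 ⇔.trans (XB″⇔ j e) (⇔.sym (next-B XB⇔ j e))
          stepA = t , t∈ , src≡ , letter≡ , cv , tgt≡ , next-A (λ _ _ → ⇔.refl)
      in c″ , SA.step stepA runA , accA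

    same-language : SameLanguage D A B
    same-language w = mk⇔
      (λ ((q , X) , _ , (iq , empty) , run , acc) →
        let (c″ , runB , accB) = simulate-A run acc ([] , []) (λ y e → mk⇔ (⊥-elim ∘ empty y e) λ ())
        in (q , ⟦ encodeStore {nY} [] ⟧) , c″ , (iq , λ _ _ ()) , runB , accB)
      (λ ((q , XB) , _ , (iq , empty) , run , acc) →
        let (c″ , runA , accA) = simulate-B run acc ([] , []) (λ j e → mk⇔ (⊥-elim ∘ empty j e) λ ())
        in (q , ⟦ [] ⟧) , c″ , (iq , λ _ _ ()) , runA , accA)

  onName : {X : Set} → (Fin nY → X) → X → Fin N → X
  onName f x i with isUnit? (decode i)
  ... | yes g = f (name g)
  ... | no  _ = x

  onName-proper : ∀ {X : Set} (f : Fin nY → X) (x : X) {i} (g : IsUnit (decode i)) → onName f x i ≡ f (name g)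
  onName-proper f x {i} g with isUnit? (decode i)
  ... | yes g′ = cong f (IsUnit-unique g (name-nonStable g′) (name-true g′))
  ... | no ¬g = ⊥-elim (¬g g)

  onName-improper : ∀ {X : Set} (f : Fin nY → X) (x : X) {i} → ¬ IsUnit (decode i) → onName f x i ≡ x
  onName-improper f x {i} ¬g with isUnit? (decode i)
  ... | yes g = ⊥-elim (¬g g)
  ... | no  _ = refl

  withName : Fin nY → Bits nY → Bits nY
  withName a c x with nonStable? x
  ... | yes _ = ⁅ a ⁆ x
  ... | no  _ = c x

  withName-nonStable : ∀ a c {x} → NonStable x → withName a c x ≡ ⁅ a ⁆ x
  withName-nonStable a c {x} ns with nonStable? x
  ... | yes _ = refl
  ... | no ¬ns = ⊥-elim (¬ns ns)

  withName-stable : ∀ a c {x} → Stable x → withName a c x ≡ c x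
  withName-stable a c {x} st with nonStable? x
  ... | yes ns = ⊥-elim (ns st)
  ... | no  _ = refl

  withName-IsUnit : ∀ {a} c → NonStable a → IsUnit (withName a c)
  withName-IsUnit {a} c pa =
    a , pa , trans (withName-nonStable a c pa) (from (⁅⁆-true a a) refl) ,
    λ y py w → sym (to (⁅⁆-true a y) (trans (sym (withName-nonStable a c py)) w))

  withName-self : ∀ {c} (g : IsUnit c) → withName (name g) c ≗ c
  withName-self {c} g@(a , _ , ca , _) x = [ withName-stable a c , nonStable-case ]′ (toSum (stable? x))
    where
    nonStable-case : NonStable x → withName a c x ≡ c x
    nonStable-case ns = trans (withName-nonStable a c ns) (bool-ext (⇔.trans (⁅⁆-true a x)
      (mk⇔ (λ a≡x → subst (λ w → c w ≡ true) a≡x ca) (λ cx → sym (IsUnit-unique g ns cx)))))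

  module Ordering (normal : Normal) where
    open ≡-Reasoning

    image-withName : ∀ {t} → t ∈ Δ → ∀ {a b c} → NonStable a → rho t a b ≡ true →
      image (rho t) (withName a c) ≗ withName b c
    image-withName {t} t∈ {a} {b} {c} pa r x = [ stable-case , nonStable-case ]′ (toSum (stable? x))
      where
      stable-case : Stable x → image (rho t) (withName a c) x ≡ withName b c x
      stable-case st = trans (bool-ext (⇔.trans (image-true (rho t) _ x) (mk⇔
          (λ (x′ , w , r′) → trans (sym (withName-stable a c st))
                                   (subst (λ v → withName a c v ≡ true) (stable-predecessor t∈ st r′) w))
          (λ cx → x , trans (withName-stable a c st) cx , from (proj₁ (st t t∈ x)) refl))))
        (sym (withName-stable b c st))
      nonStable-case : NonStable x → image (rho t) (withName a c) x ≡ withName b c x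
      nonStable-case ns = trans (bool-ext (⇔.trans (mk⇔
          (λ im → successor-unique t∈ normal pa r (image-unit-edge t∈ (withName-IsUnit c pa) ns im))
          (λ b≡x → from (image-true (rho t) _ x)
                     (a , name-true (withName-IsUnit c pa) , subst (λ v → rho t a v ≡ true) b≡x r)))
          (⇔.sym (⁅⁆-true b x))))
        (sym (withName-nonStable b c ns))

    follow-IsUnit : ∀ {t} → t ∈ Δ → ∀ i → IsUnit (decode (follow t i))
    follow-IsUnit {t} t∈ i with isUnit? (decode i)
    ... | yes g = IsUnit-decode-encode (image-IsUnit t∈ normal g)
    ... | no  _ = IsUnit-decode-encode (uvec-IsUnit t∈ normal)

    edge-follow : ∀ {i j} → NB.Upd i j → ∃[ t ] (t ∈ Δ × follow t i ≡ j)
    edge-follow (_ , _ , t′ , t′∈ , r) with ∈-map⁻ normalise t′∈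
    ... | t , t∈ , refl = t , t∈ , to (⁅⁆-true _ _) r

    follow-edge : ∀ {t} → t ∈ Δ → ∀ i → NB.Upd i (follow t i)
    follow-edge {t} t∈ i = tt , tt , normalise t , ∈-map⁺ normalise t∈ , from (⁅⁆-true (follow t i) _) refl

    target-IsUnit : ∀ {i j} → NB.Upd⁺ i j → IsUnit (decode j)
    target-IsUnit [ e ] with edge-follow e
    ... | _ , t∈ , refl = follow-IsUnit t∈ _
    target-IsUnit (_ ∷ p) = target-IsUnit p

    improper-bounded : ∀ {i} → ¬ IsUnit (decode i) → NB.Bounded i
    improper-bounded ¬g (_ , cycle , inj₁ refl) = ¬g (target-IsUnit cycle)
    improper-bounded ¬g (_ , _ , inj₂ path)     = ¬g (target-IsUnit path)

    unbounded-proper : ∀ {i} → ¬ NB.Bounded i → IsUnit (decode i)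
    unbounded-proper {i} ¬b = decidable-stable (isUnit? (decode i)) (¬b ∘ improper-bounded)

    successor-unbounded : ∀ {i j} → NB.Upd i j → ¬ NB.Bounded i → ¬ NB.Bounded j
    successor-unbounded e ¬bi bj = ¬bi λ
      { (z , cycle , inj₁ refl) → bj (z , cycle , inj₂ [ e ])
      ; (z , cycle , inj₂ path) → bj (z , cycle , inj₂ (path ∷ʳ e)) }

    follow-name : ∀ {t} → t ∈ Δ → ∀ {i} (gi : IsUnit (decode i)) (gj : IsUnit (decode (follow t i))) →
      rho t (name gi) (name gj) ≡ true
    follow-name {t} t∈ {i} gi gj = image-unit-edge t∈ gi (name-nonStable gj) (begin
      image (rho t) (decode i) (name gj)                   ≡⟨ decode-encode _ (name gj) ⟨
      decode (encode (image (rho t) (decode i))) (name gj) ≡⟨ cong (λ k → decode k (name gj)) (follow-proper t gi) ⟨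
      decode (follow t i) (name gj)                        ≡⟨ name-true gj ⟩
      true                                                 ∎)

    name-edge : ∀ {t} → t ∈ Δ → ∀ {i} (gi : IsUnit (decode i)) (gj : IsUnit (decode (follow t i))) →
      Upd (name gi) (name gj)
    name-edge {t} t∈ gi gj = name-nonStable gi , name-nonStable gj , t , t∈ , follow-name t∈ gi gj

    project : ∀ {i j} → NB.Upd⁺ i j → (gi : IsUnit (decode i)) (gj : IsUnit (decode j)) →
      Upd⁺ (name gi) (name gj)
    project [ e ] gi gj with edge-follow e
    ... | _ , t∈ , refl = [ name-edge t∈ gi gj ]
    project (e ∷ p) gi gj with edge-follow e
    ... | _ , t∈ , refl = name-edge t∈ gi (follow-IsUnit t∈ _) ∷ project p (follow-IsUnit t∈ _) gj

    lift-edge : ∀ {a b} → Upd a b → ∀ c → NB.Upd (encode (withName a c)) (encode (withName b c))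
    lift-edge (pa , _ , t , t∈ , r) c = subst (NB.Upd _)
      (trans (follow-encode t (withName-IsUnit c pa)) (encode-cong (image-withName t∈ pa r)))
      (follow-edge t∈ _)

    lift : ∀ {a b} → Upd⁺ a b → ∀ c → NB.Upd⁺ (encode (withName a c)) (encode (withName b c))
    lift [ e ]   c = [ lift-edge e c ]
    lift (e ∷ p) c = lift-edge e c ∷ lift p c

    encode-withName-self : ∀ {i} (g : IsUnit (decode i)) → encode (withName (name g) (decode i)) ≡ i
    encode-withName-self {i} g = trans (encode-cong (withName-self g)) (encode-decode {nY} i)

    Bounded⇔ : ∀ {i} (g : IsUnit (decode i)) → NB.Bounded i ⇔ Bounded (name g)
    Bounded⇔ {i} g = mk⇔ bounded-A bounded-B
      where
      bounded-A : NB.Bounded i → Bounded (name g)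
      bounded-A bB (a , cycle , reach) =
        bB (encode (withName a (decode i)) , lift cycle (decode i) , lift-reach reach)
        where
        lift-reach : a ≡ name g ⊎ Upd⁺ a (name g) →
          encode (withName a (decode i)) ≡ i ⊎ NB.Upd⁺ (encode (withName a (decode i))) i
        lift-reach (inj₁ refl) = inj₁ (encode-withName-self g)
        lift-reach (inj₂ path) = inj₂ (subst (NB.Upd⁺ _) (encode-withName-self g) (lift path (decode i)))
      bounded-B : Bounded (name g) → NB.Bounded i
      bounded-B bA (z , cycle , reach) = bA (name gz , project cycle gz gz , project-reach reach)
        where
        gz : IsUnit (decode z)
        gz = target-IsUnit cycle
        project-reach : z ≡ i ⊎ NB.Upd⁺ z i → name gz ≡ name g ⊎ Upd⁺ (name gz) (name g)
        project-reach (inj₁ refl) = inj₁ (IsUnit-unique g (name-nonStable gz) (name-true gz))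
        project-reach (inj₂ path) = inj₂ (project path gz g)

    follow-fixed : ∀ {t} → t ∈ Δ → ∀ {i} (g : IsUnit (decode i)) →
      rho t (name g) (name g) ≡ true → follow t i ≡ i
    follow-fixed {t} t∈ {i} g@(a , pa , _ , _) r = begin
      follow t i                                     ≡⟨ follow-proper t g ⟩
      encode (image (rho t) (decode i))              ≡⟨ encode-cong (image-cong (rho t) (sym ∘ withName-self g)) ⟩
      encode (image (rho t) (withName a (decode i))) ≡⟨ encode-cong (image-withName t∈ pa r) ⟩
      encode (withName a (decode i))                 ≡⟨ encode-withName-self g ⟩
      i                                              ∎

    module Ranking (rankA : Fin nY → ℕ) where

      bound : ℕ
      bound = max 0 (map rankA (allFin nY))

      rankA≤bound : ∀ y → rankA y ≤ bound
      rankA≤bound y = All.lookup (xs≤max 0 (map rankA (allFin nY))) (∈-map⁺ rankA (∈-allFin y))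

      level : Fin N → Fin (suc (suc bound))
      level = onName (λ y → fromℕ< (s≤s (m≤n⇒m≤1+n (rankA≤bound y)))) (fromℕ (suc bound))

      level-proper : ∀ {i} (g : IsUnit (decode i)) → toℕ (level i) ≡ rankA (name g)
      level-proper g = trans (cong toℕ (onName-proper _ _ g)) (toℕ-fromℕ< _)

      level-improper : ∀ {i} → ¬ IsUnit (decode i) → toℕ (level i) ≡ suc bound
      level-improper ¬g = trans (cong toℕ (onName-improper _ _ ¬g)) (toℕ-fromℕ _)

      rankB : Fin N → ℕ
      rankB i = toℕ (combine (level i) i)

      rankB-injective : ∀ {i j} → rankB i ≡ rankB j → i ≡ j
      rankB-injective {i} {j} eq = combine-injectiveʳ (level i) i (level j) j (toℕ-injective eq)

      rankB-mono : ∀ {i j} (gi : IsUnit (decode i)) (gj : IsUnit (decode j)) →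
        rankA (name gi) < rankA (name gj) → rankB i < rankB j
      rankB-mono {i} {j} gi gj lt =
        combine-monoˡ-< i j (subst₂ _<_ (sym (level-proper gi)) (sym (level-proper gj)) lt)

      A-unbounded : ∀ {i} (¬b : ¬ NB.Bounded i) → ¬ Bounded (name (unbounded-proper ¬b))
      A-unbounded ¬b = ¬b ∘ from (Bounded⇔ (unbounded-proper ¬b))

      rankB-unbounded<bounded :
        (∀ x y → NonStable x → NonStable y → ¬ Bounded x → Bounded y → rankA x < rankA y) →
        ∀ {i j} → ¬ NB.Bounded i → NB.Bounded j → rankB i < rankB j
      rankB-unbounded<bounded unbounded<bounded {i} {j} ¬bi bj =
        [ proper , improper ]′ (toSum (isUnit? (decode j)))
        where
        gi : IsUnit (decode i)
        gi = unbounded-proper ¬bi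
        proper : IsUnit (decode j) → rankB i < rankB j
        proper gj = rankB-mono gi gj
          (unbounded<bounded _ _ (name-nonStable gi) (name-nonStable gj) (A-unbounded ¬bi) (to (Bounded⇔ gj) bj))
        improper : ¬ IsUnit (decode j) → rankB i < rankB j
        improper ¬gj = combine-monoˡ-< i j
          (subst₂ _<_ (sym (level-proper gi)) (sym (level-improper ¬gj)) (s≤s (rankA≤bound _)))

      partition-normalise : ∀ {t} → t ∈ Δ → UpdatePartition rankA t → RB.UpdatePartition rankB (normalise t)
      partition-normalise {t} t∈ (side , below , leaves , fixes) = sideB , belowB , leavesB , fixesB
        where
        sideB : Fin N → Bool
        sideB = onName side true
        side-A : ∀ {i} (¬b : ¬ NB.Bounded i) → sideB i ≡ side (name (unbounded-proper ¬b))
        side-A ¬b = onName-proper side true (unbounded-proper ¬b)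
        belowB : ∀ x y → ⊤ → ⊤ → ¬ NB.Bounded x → ¬ NB.Bounded y →
          sideB x ≡ false → sideB y ≡ true → rankB x < rankB y
        belowB x y _ _ ¬bx ¬by sx sy = rankB-mono (unbounded-proper ¬bx) (unbounded-proper ¬by)
          (below _ _ (name-nonStable (unbounded-proper ¬bx)) (name-nonStable (unbounded-proper ¬by))
             (A-unbounded ¬bx) (A-unbounded ¬by) (trans (sym (side-A ¬bx)) sx) (trans (sym (side-A ¬by)) sy))
        leavesB : ∀ x y → ⊤ → ⊤ → ¬ NB.Bounded x → sideB x ≡ false →
          ⁅ follow t x ⁆ y ≡ true → (¬ NB.Bounded y × sideB y ≡ true)
        leavesB x y _ _ ¬bx sx r with to (⁅⁆-true (follow t x) y) r
        ... | refl = successor-unbounded (follow-edge t∈ x) ¬bx ,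
          trans (onName-proper side true gy)
            (proj₂ (leaves _ _ (name-nonStable gx) (name-nonStable gy) (A-unbounded ¬bx)
              (trans (sym (side-A ¬bx)) sx) (follow-name t∈ gx gy)))
          where
          gx : IsUnit (decode x)
          gx = unbounded-proper ¬bx
          gy : IsUnit (decode (follow t x))
          gy = follow-IsUnit t∈ x
        fixesB : ∀ x → ⊤ → ¬ NB.Bounded x → sideB x ≡ true →
          ⁅ follow t x ⁆ x ≡ true × (∀ y → ⊤ → ⁅ follow t x ⁆ y ≡ true → y ≡ x)
        fixesB x _ ¬bx sx =
          from (⁅⁆-true (follow t x) x) fixed , λ y _ r → trans (sym (to (⁅⁆-true (follow t x) y) r)) fixed
          where
          gx : IsUnit (decode x)
          gx = unbounded-proper ¬bx
          fixed : follow t x ≡ x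
          fixed = follow-fixed t∈ gx
            (proj₁ (fixes _ (name-nonStable gx) (A-unbounded ¬bx) (trans (sym (side-A ¬bx)) sx)))

  B-ordered : OrderedQuasiNormal → NB.Ordered
  B-ordered (normal , rankA , _ , unbounded<bounded , partitions) =
    B-normal , rankB , (λ _ _ _ _ → rankB-injective) , (λ _ _ _ _ → rankB-unbounded<bounded unbounded<bounded) ,
    partitionsB
    where
    open Ordering normal
    open Ranking rankA
    partitionsB : ∀ t′ → t′ ∈ map normalise Δ → RB.UpdatePartition rankB t′
    partitionsB t′ t′∈ with ∈-map⁻ normalise t′∈
    ... | t , t∈ , refl = partition-normalise t∈ (partitions t t∈)

proposition20 : (D : Set) → Infinite D → (nΣ : ℕ) → (A : SetAutomaton nΣ) →
    Structure.OrderedQuasiNormal A →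
    ∃[ B ] (Structure.OrderedNormal B × SameLanguage D A B)
-- The construction works over any data domain; D need not be infinite.
proposition20 D _ nΣ A ordered = B , B-ordered ordered , Simulation.same-language D (proj₁ ordered)
  where open Normalisation A
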